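{- None of the following classes has the amalgamation property: (i) linearly ordered sets with two order reversing unary operations; (ii) linearly ordered sets with two strict order reversing unary operations; (iii) linearly ordered sets with one order preserving and one order reversing unary operation. Moreover, each of these classes still fails the amalgamation property when restricted to those structures in which the two operations have a common center (a common element $c$ with $f(c)=c$ for both operations $f$).
   Context: A unary $f$ on an ordered set is order preserving if $a\le b$ implies $f(a)\le f(b)$; order reversing if $a\le b$ implies $f(a)\ge f(b)$; strict order reversing if $a<b$ implies $f(a)>f(b)$. Embeddings are injective maps commuting with all operations and satisfying $x\le y\iff\iota(x)\le\iota(y)$. A class $\mathcal K$ has the amalgamation property (AP) if whenever $\mathbf A,\mathbf B,\mathbf C\in\mathcal K$ and $\iota_1:\mathbf C\to\mathbf A$, $\iota_2:\mathbf C\to\mathbf B$ are embeddings, there exist $\mathbf D\in\mathcal K$ and embeddings $j_1:\mathbf A\to\mathbf D$, $j_2:\mathbf B\to\mathbf D$ with $j_1\circ\iota_1=j_2\circ\iota_2$. -}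

module Defs where

open import Level using (0ℓ)
open import Data.Product using (Σ; _×_; _,_)
open import Relation.Binary.PropositionalEquality using (_≡_; _≢_)
open import Relation.Binary.Structures using (IsTotalOrder)
open import Function.Definitions using (Injective)

record LOS2 : Set₁ where
  field
    Carrier      : Set
    _≤_          : Carrier → Carrier → Set
    isTotalOrder : IsTotalOrder _≡_ _≤_
    f            : Carrier → Carrier
    g            : Carrier → Carrier

Class : Set₁
Class = LOS2 → Set

module _ (A : LOS2) where
  open LOS2 A

  _<_ : Carrier → Carrier → Set
  a < b = (a ≤ b) × (a ≢ b)

  OrderPreserving : (Carrier → Carrier) → Set
  OrderPreserving h = ∀ a b → a ≤ b → h a ≤ h b

  OrderReversing : (Carrier → Carrier) → Set
  OrderReversing h = ∀ a b → a ≤ b → h b ≤ h a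

  StrictOrderReversing : (Carrier → Carrier) → Set
  StrictOrderReversing h = ∀ a b → a < b → h b < h a

  HasCommonCenter : Set
  HasCommonCenter = Σ Carrier (λ c → (f c ≡ c) × (g c ≡ c))

record Embedding (A B : LOS2) : Set where
  private
    module A = LOS2 A
    module B = LOS2 B
  field
    map       : A.Carrier → B.Carrier
    injective : Injective _≡_ _≡_ map
    map-f     : ∀ x → map (A.f x) ≡ B.f (map x)
    map-g     : ∀ x → map (A.g x) ≡ B.g (map x)
    order     : ∀ x y → (x A.≤ y → map x B.≤ map y) × (map x B.≤ map y → x A.≤ y)

AP : Class → Set₁
AP K = (A B C : LOS2) → K A → K B → K C →
       (ι₁ : Embedding C A) (ι₂ : Embedding C B) →
       Σ LOS2 λ D → K D × Σ (Embedding A D) λ j₁ → Σ (Embedding B D) λ j₂ →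
         ∀ x → Embedding.map j₁ (Embedding.map ι₁ x) ≡ Embedding.map j₂ (Embedding.map ι₂ x)

TwoReversing : Class
TwoReversing A = OrderReversing A (LOS2.f A) × OrderReversing A (LOS2.g A)

TwoStrictReversing : Class
TwoStrictReversing A = StrictOrderReversing A (LOS2.f A) × StrictOrderReversing A (LOS2.g A)

PreservingReversing : Class
PreservingReversing A = OrderPreserving A (LOS2.f A) × OrderReversing A (LOS2.g A)

WithCommonCenter : Class → Class
WithCommonCenter K A = K A × HasCommonCenter A

module Submission where

open import Defs
open import Data.Product using (_×_; _,_; proj₁; proj₂)
open import Data.Sum using (inj₁; inj₂)
open import Data.Empty using (⊥)
open import Function using (_∘_)
open import Relation.Nullary using (¬_; yes; no; contradiction)
open import Relation.Nullary.Decidable using (from-yes; from-no)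
open import Relation.Binary.Definitions using (Monotonic₁)
open import Relation.Binary.Structures using (IsTotalOrder)
open import Relation.Binary.PropositionalEquality using (_≡_; _≢_; refl; sym; trans; cong; subst)
open import Data.Integer as ℤ using (ℤ; +_; _+_; _*_; -_; _-_; _≟_; _≤?_)
import Data.Integer.Properties as ℤ
open import Data.Integer.Tactic.RingSolver using (solve-∀)
import Data.Nat as ℕ
open import Data.Nat.Divisibility using (_∣_; _∣?_; m∣m*n)

-- The base structure C is ℤ with operations built from n ↦ ±2n, embedded in A and B
-- (both carried by ℤ) as the even integers.  The odd point 3 lies in the same cut of
-- 2ℤ in A and in B, but A and B perturb the operations at 3 in opposite directions,
-- so that f 3 and g 3 fall on opposite sides of an even point in A and in B.  In an
-- amalgam the images x, y of the two copies of 3 are comparable; whichever way they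
-- compare, monotonicity of f or of g forces an inequality between the images of f 3
-- (or g 3) and of that even point which fails in A or in B, while embeddings reflect
-- the order.

module _ (D : LOS2) where
  open LOS2 D
  open IsTotalOrder isTotalOrder using (total; reflexive)

  -- Equality in D need not be decidable, so a strictly order reversing map is only
  -- order reversing up to double negation; that is enough to derive ⊥.
  ¬¬OrderReversing : (Carrier → Carrier) → Set
  ¬¬OrderReversing k = ∀ a b → a ≤ b → ¬ ¬ (k b ≤ k a)

  OrderReversing⇒¬¬OrderReversing : ∀ {k} → OrderReversing D k → ¬¬OrderReversing k
  OrderReversing⇒¬¬OrderReversing rev a b a≤b ¬kb≤ka = ¬kb≤ka (rev a b a≤b)

  StrictOrderReversing⇒¬¬OrderReversing : ∀ {k} → StrictOrderReversing D k → ¬¬OrderReversing k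
  StrictOrderReversing⇒¬¬OrderReversing srev a b a≤b ¬kb≤ka = ¬kb≤ka (proj₁ (srev a b (a≤b , a≢b)))
    where
    a≢b : a ≢ b
    a≢b refl = ¬kb≤ka (reflexive refl)

  ¬¬OrderReversing-pair-agree : ∀ {φ ψ} → ¬¬OrderReversing φ → ¬¬OrderReversing ψ →
                                ∀ x y → ¬ φ y ≤ φ x → ¬ ψ x ≤ ψ y → ⊥
  ¬¬OrderReversing-pair-agree φ-rev ψ-rev x y ¬φy≤φx ¬ψx≤ψy with total x y
  ... | inj₁ x≤y = φ-rev x y x≤y ¬φy≤φx
  ... | inj₂ y≤x = ψ-rev y x y≤x ¬ψx≤ψy

  preserving-reversing-pair-disagree : ∀ {φ ψ} → OrderPreserving D φ → OrderReversing D ψ →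
                                       ∀ x y → ¬ φ x ≤ φ y → ¬ ψ x ≤ ψ y → ⊥
  preserving-reversing-pair-disagree φ-pres ψ-rev x y ¬φx≤φy ¬ψx≤ψy with total x y
  ... | inj₁ x≤y = ¬φx≤φy (φ-pres x y x≤y)
  ... | inj₂ y≤x = ¬ψx≤ψy (ψ-rev y x y≤x)

≰-across-shared-point : ∀ {A B D} (j : Embedding A D) (j′ : Embedding B D) →
                        let open Embedding in
                        ∀ {c c′ t s} → map j c ≡ map j′ c′ →
                        LOS2._≤_ A t c → ¬ LOS2._≤_ B s c′ → ¬ LOS2._≤_ D (map j′ s) (map j t)
≰-across-shared-point {D = D} j j′ {c} {c′} {t} {s} jc≡j′c′ t≤c s≰c′ j′s≤jt =
  s≰c′ (proj₂ (order j′ s c′) (subst (map j′ s ≤_) jc≡j′c′ j′s≤jc))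

  where
  open Embedding
  open LOS2 D
  open IsTotalOrder isTotalOrder renaming (trans to ≤-trans)
  j′s≤jc : map j′ s ≤ map j c
  j′s≤jc = ≤-trans j′s≤jt (proj₁ (order j t c) t≤c)

module _ {A B C : LOS2} (ι₁ : Embedding C A) (ι₂ : Embedding C B) where
  open Embedding

  Unamalgamable : Class → Set₁
  Unamalgamable K = ∀ D → K D → (j₁ : Embedding A D) (j₂ : Embedding B D) →
                    (∀ x → map j₁ (map ι₁ x) ≡ map j₂ (map ι₂ x)) → ⊥

  Unamalgamable⇒¬AP : ∀ {K} → K A → K B → K C → Unamalgamable K → ¬ AP K
  Unamalgamable⇒¬AP kA kB kC unamalgamable ap
    with ap A B C kA kB kC ι₁ ι₂
  ... | D , kD , j₁ , j₂ , j₁ι₁≡j₂ι₂ = unamalgamable D kD j₁ j₂ j₁ι₁≡j₂ι₂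

  Unamalgamable⇒¬AP-WithCommonCenter : ∀ {K} → K A → K B → K C →
                                       HasCommonCenter A → HasCommonCenter B → HasCommonCenter C →
                                       Unamalgamable K → ¬ AP K × ¬ AP (WithCommonCenter K)
  Unamalgamable⇒¬AP-WithCommonCenter kA kB kC cA cB cC unamalgamable =
    Unamalgamable⇒¬AP kA kB kC unamalgamable ,
    Unamalgamable⇒¬AP (kA , cA) (kB , cB) (kC , cC) (λ D (kD , _) → unamalgamable D kD)

ℤ-LOS : (ℤ → ℤ) → (ℤ → ℤ) → LOS2
ℤ-LOS f g = record
  { Carrier = ℤ ; _≤_ = ℤ._≤_ ; isTotalOrder = ℤ.≤-isTotalOrder ; f = f ; g = g }

ℤ-LOS-center : ∀ {f g} → f (+ 0) ≡ + 0 → g (+ 0) ≡ + 0 → HasCommonCenter (ℤ-LOS f g)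
ℤ-LOS-center f0≡0 g0≡0 = + 0 , f0≡0 , g0≡0

StrictlyIncreasing StrictlyDecreasing : (ℤ → ℤ) → Set
StrictlyIncreasing = Monotonic₁ ℤ._<_ ℤ._<_
StrictlyDecreasing = Monotonic₁ ℤ._<_ ℤ._>_

module _ {f g : ℤ → ℤ} {k : ℤ → ℤ} where

  increasing⇒OrderPreserving : StrictlyIncreasing k → OrderPreserving (ℤ-LOS f g) k
  increasing⇒OrderPreserving k-inc a b a≤b with a ≟ b
  ... | yes refl = ℤ.≤-refl
  ... | no a≢b = ℤ.<⇒≤ (k-inc (ℤ.≤∧≢⇒< a≤b a≢b))

  decreasing⇒OrderReversing : StrictlyDecreasing k → OrderReversing (ℤ-LOS f g) k
  decreasing⇒OrderReversing k-dec a b a≤b with a ≟ b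
  ... | yes refl = ℤ.≤-refl
  ... | no a≢b = ℤ.<⇒≤ (k-dec (ℤ.≤∧≢⇒< a≤b a≢b))

  decreasing⇒StrictOrderReversing : StrictlyDecreasing k → StrictOrderReversing (ℤ-LOS f g) k
  decreasing⇒StrictOrderReversing k-dec a b (a≤b , a≢b) =
    let kb<ka = k-dec (ℤ.≤∧≢⇒< a≤b a≢b) in ℤ.<⇒≤ kb<ka , ℤ.<⇒≢ kb<ka

double : ℤ → ℤ
double n = + 2 * n

double-embedding : ∀ {fC gC fA gA} →
                   (∀ n → double (fC n) ≡ fA (double n)) → (∀ n → double (gC n) ≡ gA (double n)) →
                   Embedding (ℤ-LOS fC gC) (ℤ-LOS fA gA)
double-embedding double∘fC≡fA∘double double∘gC≡gA∘double = record
  { map       = double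
  ; injective = λ {m} {n} → ℤ.*-cancelˡ-≡ (+ 2) m n
  ; map-f     = double∘fC≡fA∘double
  ; map-g     = double∘gC≡gA∘double
  ; order     = λ m n → ℤ.*-monoˡ-≤-nonNeg (+ 2) , ℤ.*-cancelˡ-≤-pos m n (+ 2)
  }

double-increasing : StrictlyIncreasing double
double-increasing = ℤ.*-monoˡ-<-pos (+ 2)

double≢3 : ∀ n → double n ≢ + 3
double≢3 n 2n≡3 = from-no (2 ∣? 3) (subst (λ m → 2 ∣ ℤ.∣ m ∣) 2n≡3 2∣∣2n∣)
  where
  2∣∣2n∣ : 2 ∣ ℤ.∣ double n ∣
  2∣∣2n∣ = subst (2 ∣_) (sym (ℤ.abs-* (+ 2) n)) (m∣m*n ℤ.∣ n ∣)

bump : ℤ → ℤ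
bump m with m ≟ + 3
... | yes _ = + 1
... | no _  = + 0

bump-double : ∀ n → bump (double n) ≡ + 0
bump-double n with double n ≟ + 3
... | yes 2n≡3 = contradiction 2n≡3 (double≢3 n)
... | no _     = refl

bump-≤ : ∀ m n → bump m ℤ.≤ + 1 + bump n
bump-≤ m n with m ≟ + 3 | n ≟ + 3
... | yes _ | yes _ = ℤ.+≤+ (ℕ.s≤s ℕ.z≤n)
... | yes _ | no _  = ℤ.+≤+ (ℕ.s≤s ℕ.z≤n)
... | no _  | yes _ = ℤ.+≤+ ℕ.z≤n
... | no _  | no _  = ℤ.+≤+ ℕ.z≤n

neg-bump-≤ : ∀ m n → - bump m ℤ.≤ + 1 - bump n
neg-bump-≤ m n with m ≟ + 3 | n ≟ + 3
... | yes _ | yes _ = ℤ.-≤+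
... | yes _ | no _  = ℤ.-≤+
... | no _  | yes _ = ℤ.+≤+ ℕ.z≤n
... | no _  | no _  = ℤ.+≤+ ℕ.z≤n

double+small-increasing : ∀ (r : ℤ → ℤ) → (∀ m n → r m ℤ.≤ + 1 + r n) →
                          StrictlyIncreasing (λ m → double m + r m)
double+small-increasing r r-small {m} {n} m<n = begin-strict
  double m + r m              ≤⟨ ℤ.+-monoʳ-≤ (double m) (r-small m n) ⟩
  double m + (+ 1 + r n)      <⟨ ℤ.+-monoʳ-< (double m) (ℤ.+-monoˡ-< (r n) 1<2) ⟩
  double m + (+ 2 + r n)      ≡⟨ double-suc m (r n) ⟩
  double (ℤ.suc m) + r n      ≤⟨ ℤ.+-monoˡ-≤ (r n) (ℤ.*-monoˡ-≤-nonNeg (+ 2) (ℤ.i<j⇒suc[i]≤j m<n)) ⟩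
  double n + r n              ∎
  where
  open ℤ.≤-Reasoning
  1<2 : + 1 ℤ.< + 2
  1<2 = ℤ.+<+ (ℕ.s≤s (ℕ.s≤s ℕ.z≤n))
  double-suc : ∀ m s → + 2 * m + (+ 2 + s) ≡ + 2 * (+ 1 + m) + s
  double-suc = solve-∀

up down : ℤ → ℤ
up m   = double m + bump m
down m = double m - bump m

up-increasing : StrictlyIncreasing up
up-increasing = double+small-increasing bump bump-≤

down-increasing : StrictlyIncreasing down
down-increasing = double+small-increasing (-_ ∘ bump) neg-bump-≤

double∘double≡up∘double : ∀ n → double (double n) ≡ up (double n)
double∘double≡up∘double n rewrite bump-double n = sym (ℤ.+-identityʳ _)

double∘double≡down∘double : ∀ n → double (double n) ≡ down (double n)
double∘double≡down∘double n rewrite bump-double n = sym (ℤ.+-identityʳ _)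

neg-double neg-up neg-down : ℤ → ℤ
neg-double = -_ ∘ double
neg-up     = -_ ∘ up
neg-down   = -_ ∘ down

neg-decreasing : ∀ {k} → StrictlyIncreasing k → StrictlyDecreasing (-_ ∘ k)
neg-decreasing k-inc m<n = ℤ.neg-mono-< (k-inc m<n)

neg-double-decreasing : StrictlyDecreasing neg-double
neg-double-decreasing = neg-decreasing double-increasing

neg-up-decreasing : StrictlyDecreasing neg-up
neg-up-decreasing = neg-decreasing up-increasing

neg-down-decreasing : StrictlyDecreasing neg-down
neg-down-decreasing = neg-decreasing down-increasing

double∘neg-double≡neg-up∘double : ∀ n → double (neg-double n) ≡ neg-up (double n)
double∘neg-double≡neg-up∘double n =
  trans (sym (ℤ.neg-distribʳ-* (+ 2) (double n))) (cong -_ (double∘double≡up∘double n))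

double∘neg-double≡neg-down∘double : ∀ n → double (neg-double n) ≡ neg-down (double n)
double∘neg-double≡neg-down∘double n =
  trans (sym (ℤ.neg-distribʳ-* (+ 2) (double n))) (cong -_ (double∘double≡down∘double n))

decreasing-pair⇒TwoReversing : ∀ {f g} → StrictlyDecreasing f → StrictlyDecreasing g →
                               TwoReversing (ℤ-LOS f g)
decreasing-pair⇒TwoReversing {f} {g} f-dec g-dec =
  decreasing⇒OrderReversing {f} {g} f-dec , decreasing⇒OrderReversing {f} {g} g-dec

decreasing-pair⇒TwoStrictReversing : ∀ {f g} → StrictlyDecreasing f → StrictlyDecreasing g →
                                     TwoStrictReversing (ℤ-LOS f g)
decreasing-pair⇒TwoStrictReversing {f} {g} f-dec g-dec =
  decreasing⇒StrictOrderReversing {f} {g} f-dec , decreasing⇒StrictOrderReversing {f} {g} g-dec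

increasing-decreasing⇒PreservingReversing : ∀ {f g} → StrictlyIncreasing f → StrictlyDecreasing g →
                                            PreservingReversing (ℤ-LOS f g)
increasing-decreasing⇒PreservingReversing {f} {g} f-inc g-dec =
  increasing⇒OrderPreserving {f} {g} f-inc , decreasing⇒OrderReversing {f} {g} g-dec

Cʳ Aʳ Bʳ Cᵖ Aᵖ Bᵖ : LOS2
Cʳ = ℤ-LOS neg-double neg-double
Aʳ = ℤ-LOS neg-up neg-down
Bʳ = ℤ-LOS neg-down neg-up
Cᵖ = ℤ-LOS double neg-double
Aᵖ = ℤ-LOS up neg-down
Bᵖ = ℤ-LOS down neg-up

Cʳ↪Aʳ : Embedding Cʳ Aʳ
Cʳ↪Aʳ = double-embedding double∘neg-double≡neg-up∘double double∘neg-double≡neg-down∘double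

Cʳ↪Bʳ : Embedding Cʳ Bʳ
Cʳ↪Bʳ = double-embedding double∘neg-double≡neg-down∘double double∘neg-double≡neg-up∘double

Cᵖ↪Aᵖ : Embedding Cᵖ Aᵖ
Cᵖ↪Aᵖ = double-embedding double∘double≡up∘double double∘neg-double≡neg-down∘double

Cᵖ↪Bᵖ : Embedding Cᵖ Bᵖ
Cᵖ↪Bᵖ = double-embedding double∘double≡down∘double double∘neg-double≡neg-up∘double

-- At 3, neg-up, neg-down, up and down take the values −7, −5, 7, 5, which lie on
-- either side of double (−3) = −6, respectively of double 3 = 6.
module Amalgam {fA fB : ℤ → ℤ} {D : LOS2}
               (j₁ : Embedding (ℤ-LOS fA neg-down) D) (j₂ : Embedding (ℤ-LOS fB neg-up) D)
               (agree : ∀ n → Embedding.map j₁ (double n) ≡ Embedding.map j₂ (double n)) where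
  open Embedding
  open LOS2 D

  x y : Carrier
  x = map j₁ (+ 3)
  y = map j₂ (+ 3)

  j₂≰j₁ : ∀ n {s t} → t ℤ.≤ double n → ¬ s ℤ.≤ double n → ¬ map j₂ s ≤ map j₁ t
  j₂≰j₁ n = ≰-across-shared-point j₁ j₂ (agree n)

  j₁≰j₂ : ∀ n {s t} → t ℤ.≤ double n → ¬ s ℤ.≤ double n → ¬ map j₁ s ≤ map j₂ t
  j₁≰j₂ n = ≰-across-shared-point j₂ j₁ (sym (agree n))

  ¬gx≤gy : ¬ g x ≤ g y
  ¬gx≤gy rewrite sym (map-g j₁ (+ 3)) | sym (map-g j₂ (+ 3)) =
    j₁≰j₂ (- + 3) (from-yes (neg-up (+ 3) ≤? double (- + 3)))
                  (from-no (neg-down (+ 3) ≤? double (- + 3)))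

reversing-span-unamalgamable : ∀ {D} → ¬¬OrderReversing D (LOS2.f D) → ¬¬OrderReversing D (LOS2.g D) →
                               (j₁ : Embedding Aʳ D) (j₂ : Embedding Bʳ D) →
                               (∀ n → Embedding.map j₁ (double n) ≡ Embedding.map j₂ (double n)) → ⊥
reversing-span-unamalgamable {D} f-rev g-rev j₁ j₂ agree =
  ¬¬OrderReversing-pair-agree D f-rev g-rev x y ¬fy≤fx ¬gx≤gy
  where
  open Amalgam j₁ j₂ agree
  open LOS2 D
  ¬fy≤fx : ¬ f y ≤ f x
  ¬fy≤fx rewrite sym (Embedding.map-f j₁ (+ 3)) | sym (Embedding.map-f j₂ (+ 3)) =
    j₂≰j₁ (- + 3) (from-yes (neg-up (+ 3) ≤? double (- + 3)))
                  (from-no (neg-down (+ 3) ≤? double (- + 3)))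

preserving-span-unamalgamable : ∀ {D} → PreservingReversing D →
                                (j₁ : Embedding Aᵖ D) (j₂ : Embedding Bᵖ D) →
                                (∀ n → Embedding.map j₁ (double n) ≡ Embedding.map j₂ (double n)) → ⊥
preserving-span-unamalgamable {D} (f-pres , g-rev) j₁ j₂ agree =
  preserving-reversing-pair-disagree D f-pres g-rev x y ¬fx≤fy ¬gx≤gy
  where
  open Amalgam j₁ j₂ agree
  open LOS2 D
  ¬fx≤fy : ¬ f x ≤ f y
  ¬fx≤fy rewrite sym (Embedding.map-f j₁ (+ 3)) | sym (Embedding.map-f j₂ (+ 3)) =
    j₁≰j₂ (+ 3) (from-yes (down (+ 3) ≤? double (+ 3))) (from-no (up (+ 3) ≤? double (+ 3)))

¬AP-TwoReversing : ¬ AP TwoReversing × ¬ AP (WithCommonCenter TwoReversing)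
¬AP-TwoReversing = Unamalgamable⇒¬AP-WithCommonCenter Cʳ↪Aʳ Cʳ↪Bʳ
  (decreasing-pair⇒TwoReversing neg-up-decreasing neg-down-decreasing)
  (decreasing-pair⇒TwoReversing neg-down-decreasing neg-up-decreasing)
  (decreasing-pair⇒TwoReversing neg-double-decreasing neg-double-decreasing)
  (ℤ-LOS-center refl refl) (ℤ-LOS-center refl refl) (ℤ-LOS-center refl refl)
  λ D (f-rev , g-rev) → reversing-span-unamalgamable
    (OrderReversing⇒¬¬OrderReversing D f-rev) (OrderReversing⇒¬¬OrderReversing D g-rev)

¬AP-TwoStrictReversing : ¬ AP TwoStrictReversing × ¬ AP (WithCommonCenter TwoStrictReversing)
¬AP-TwoStrictReversing = Unamalgamable⇒¬AP-WithCommonCenter Cʳ↪Aʳ Cʳ↪Bʳ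
  (decreasing-pair⇒TwoStrictReversing neg-up-decreasing neg-down-decreasing)
  (decreasing-pair⇒TwoStrictReversing neg-down-decreasing neg-up-decreasing)
  (decreasing-pair⇒TwoStrictReversing neg-double-decreasing neg-double-decreasing)
  (ℤ-LOS-center refl refl) (ℤ-LOS-center refl refl) (ℤ-LOS-center refl refl)
  λ D (f-rev , g-rev) → reversing-span-unamalgamable
    (StrictOrderReversing⇒¬¬OrderReversing D f-rev) (StrictOrderReversing⇒¬¬OrderReversing D g-rev)

¬AP-PreservingReversing : ¬ AP PreservingReversing × ¬ AP (WithCommonCenter PreservingReversing)
¬AP-PreservingReversing = Unamalgamable⇒¬AP-WithCommonCenter Cᵖ↪Aᵖ Cᵖ↪Bᵖ
  (increasing-decreasing⇒PreservingReversing up-increasing neg-down-decreasing)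
  (increasing-decreasing⇒PreservingReversing down-increasing neg-up-decreasing)
  (increasing-decreasing⇒PreservingReversing double-increasing neg-double-decreasing)
  (ℤ-LOS-center refl refl) (ℤ-LOS-center refl refl) (ℤ-LOS-center refl refl)
  λ D → preserving-span-unamalgamable

theorem4p3 : (¬ AP TwoReversing) × (¬ AP TwoStrictReversing) × (¬ AP PreservingReversing)
           × (¬ AP (WithCommonCenter TwoReversing)) × (¬ AP (WithCommonCenter TwoStrictReversing))
           × (¬ AP (WithCommonCenter PreservingReversing))
theorem4p3 =
  let ¬AP-i   , ¬AP-iᶜ   = ¬AP-TwoReversing
      ¬AP-ii  , ¬AP-iiᶜ  = ¬AP-TwoStrictReversing
      ¬AP-iii , ¬AP-iiiᶜ = ¬AP-PreservingReversing
  in ¬AP-i , ¬AP-ii , ¬AP-iii , ¬AP-iᶜ , ¬AP-iiᶜ , ¬AP-iiiᶜ
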